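{- Fix $n,k\in\mathbb{N}$ with $k\ge 2$ and $n>k^2+k+2$. There exists a strongly $\lfloor k^2/4\rfloor$-connected tournament $T$ of order $n$ such that whenever $D\subseteq T$ is a spanning $r$-regular subdigraph, then $r\le k$. In particular, $T$ contains at most $k$ edge-disjoint Hamilton cycles.
   Context: A digraph $D$ is strongly $m$-connected if $|D|>m$ and for every $S\subseteq V(D)$ with $|S|\le m-1$, $D-S$ is strongly connected. A digraph is $r$-regular if every vertex has in-degree and out-degree exactly $r$; spanning means it contains all vertices of $T$. -}

module Defs where

open import Data.Nat using (ℕ; zero; suc; _<_; _≤_)
open import Data.Bool using (Bool; true; false; if_then_else_)
open import Data.Fin using (Fin)
open import Data.Fin.Subset using (Subset; _∉_; ∣_∣)
open import Data.List using (List; map; allFin)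
open import Data.Nat.ListAction using (sum)
open import Data.Sum using (_⊎_)
open import Data.Product using (_×_)
open import Relation.Binary.PropositionalEquality using (_≡_; _≢_)

-- A digraph on vertex set Fin n, given by its (Boolean) adjacency relation:
-- E u v ≡ true means there is an arc u → v.
Digraph : ℕ → Set
Digraph n = Fin n → Fin n → Bool

IsTournament : ∀ {n} → Digraph n → Set
IsTournament {n} T =
  (∀ (u : Fin n) → T u u ≡ false)
  × (∀ (u v : Fin n) → u ≢ v → (T u v ≡ true) ⊎ (T v u ≡ true))
  × (∀ (u v : Fin n) → T u v ≡ true → T v u ≡ false)

data PathAvoiding {n} (D : Digraph n) (S : Subset n) : Fin n → Fin n → Set where
  here : ∀ {u} → u ∉ S → PathAvoiding D S u u
  step : ∀ {u w v} → u ∉ S → D u w ≡ true → PathAvoiding D S w v → PathAvoiding D S u v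

StronglyConnectedMinus : ∀ {n} → Digraph n → Subset n → Set
StronglyConnectedMinus {n} D S =
  ∀ (u v : Fin n) → u ∉ S → v ∉ S → PathAvoiding D S u v

-- D is strongly m-connected: |D| > m and D - S is strongly connected
-- for every S with |S| ≤ m - 1 (i.e. |S| < m).
StronglyConnected : ∀ {n} → ℕ → Digraph n → Set
StronglyConnected {n} m D =
  m < n × (∀ (S : Subset n) → ∣ S ∣ < m → StronglyConnectedMinus D S)

_⊆D_ : ∀ {n} → Digraph n → Digraph n → Set
_⊆D_ {n} D T = ∀ (u v : Fin n) → D u v ≡ true → T u v ≡ true

outdeg : ∀ {n} → Digraph n → Fin n → ℕ
outdeg {n} D u = sum (map (λ v → if D u v then 1 else 0) (allFin n))

indeg : ∀ {n} → Digraph n → Fin n → ℕ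
indeg {n} D v = sum (map (λ u → if D u v then 1 else 0) (allFin n))

Regular : ∀ {n} → Digraph n → ℕ → Set
Regular {n} D r = ∀ (u : Fin n) → (outdeg D u ≡ r) × (indeg D u ≡ r)

module Submission where

-- Order the vertices 0, …, n−1 transitively and reverse three families of arcs: the arcs of
-- length > m inside the bottom block [0, N) and inside the top block [z, n), where N = 2m + 1 and
-- z = n − N, which turns each block into the rotational tournament i → i+1, …, i+m (mod N); and the
-- m matching arcs z + i → i (i < m).  Deleting fewer than m vertices leaves both blocks strongly
-- connected and some matching arc intact; every vertex reaches the top block and is reached from the
-- bottom block, so T − S is strongly connected.
-- If D ⊆ T is r-regular with r > k, let P be the first N + k + 1 vertices.  The middle vertex N + i
-- of P has at most k − i out-neighbours in P, so at least i + 1 arcs of D leave P from it, and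
-- (k+1)(k+2)/2 > m arcs leave P in total.  Only matching arcs enter P, so at most m arcs of D enter
-- P; but in a digraph whose in- and out-degrees agree, as many arcs enter P as leave it.

open import Defs
open import Data.Nat using (ℕ; zero; suc; NonZero; _+_; _*_; _∸_; _/_; _%_; _≤_; _<_; z≤n; s≤s; _<?_; _≤?_; _≟_; _<ᵇ_)
open import Data.Nat.Properties
open import Data.Nat.DivMod using (m/n*n≤m; %-distribˡ-+; m%n%n≡m%n; m%n<n; m<n⇒m%n≡m; m≤n⇒[n∸m]%m≡n%m; [m+n]%n≡m%n)
open import Data.Nat.Induction using (<-rec)
open import Data.Nat.ListAction using () renaming (sum to listSum)
open import Data.Nat.Tactic.RingSolver using (solve-∀)
open import Data.Bool using (Bool; true; false; not; if_then_else_)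
open import Data.Bool.Properties using (T-≡)
open import Data.Fin using (Fin; zero; suc; toℕ; fromℕ<)
open import Data.Fin.Properties using (all?; ¬∀⟶∃¬; toℕ-injective; toℕ-fromℕ<; toℕ<n; fromℕ<-injective)
import Data.Fin.Properties as Fin
open import Data.Fin.Subset using (Subset; _∈_; _∉_; ∣_∣; _-_)
open import Data.Fin.Subset.Properties using (_∈?_; x∈p∧x≢y⇒x∈p-y; x∈p⇒∣p-x∣<∣p∣)
open import Data.List using (tabulate)
open import Data.List.Properties using (map-tabulate)
open import Data.Sum using (_⊎_; inj₁; inj₂; swap)
open import Data.Product using (Σ; _×_; _,_; proj₁; proj₂; ∃-syntax)
open import Function using (_∘_; id; case_of_)
open import Function.Bundles using (Equivalence)
open import Function.Definitions using (Injective)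
open import Relation.Nullary using (¬_; Dec; yes; no; does; contradiction)
open import Relation.Nullary.Decidable using (_⊎-dec_; _×-dec_; dec-true; dec-false)
open import Relation.Binary using (Tri; tri<; tri≈; tri>)
open import Relation.Binary.PropositionalEquality
open import Algebra.Properties.Semiring.Sum +-*-semiring
  using (sum; sum-syntax; ∑-distrib-+; ∑-comm; sum-cong-≗; sum-replicate-zero; *-distribˡ-sum)

ι : Bool → ℕ
ι b = if b then 1 else 0

ι≤1 : ∀ b → ι b ≤ 1
ι≤1 true = ≤-refl
ι≤1 false = z≤n

listSum-tabulate : ∀ {n} (f : Fin n → ℕ) → listSum (tabulate f) ≡ sum f
listSum-tabulate {zero} f = refl
listSum-tabulate {suc n} f = cong (f zero +_) (listSum-tabulate (f ∘ suc))

outdeg≡∑ : ∀ {n} (D : Digraph n) u → outdeg D u ≡ ∑[ v < n ] ι (D u v)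
outdeg≡∑ {n} D u = trans (cong listSum (map-tabulate id (λ v → ι (D u v)))) (listSum-tabulate {n} _)

indeg≡∑ : ∀ {n} (D : Digraph n) v → indeg D v ≡ ∑[ u < n ] ι (D u v)
indeg≡∑ {n} D v = trans (cong listSum (map-tabulate id (λ u → ι (D u v)))) (listSum-tabulate {n} _)

ι*ι≤1 : ∀ a b → ι a * ι b ≤ 1
ι*ι≤1 a b = *-mono-≤ (ι≤1 a) (ι≤1 b)

∑-zero : ∀ {n} {f : Fin n → ℕ} → (∀ i → f i ≡ 0) → sum f ≡ 0
∑-zero {n} f≡0 = trans (sum-cong-≗ f≡0) (sum-replicate-zero n)

∑-≤-length-of-support : ∀ {n} (f : Fin n → ℕ) a b → (∀ i → f i ≤ 1) →
  (∀ i → toℕ i < a ⊎ b ≤ toℕ i → f i ≡ 0) → sum f ≤ b ∸ a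
∑-≤-length-of-support {zero} f a b f≤1 outside = z≤n
∑-≤-length-of-support {suc n} f zero zero f≤1 outside =
  ≤-reflexive (∑-zero (λ i → outside i (inj₂ z≤n)))
∑-≤-length-of-support {suc n} f zero (suc b) f≤1 outside =
  +-mono-≤ (f≤1 zero) (∑-≤-length-of-support (f ∘ suc) zero b (f≤1 ∘ suc)
    λ { i (inj₂ b≤i) → outside (suc i) (inj₂ (s≤s b≤i)) })
∑-≤-length-of-support {suc n} f (suc a) b f≤1 outside rewrite outside zero (inj₁ (s≤s z≤n)) =
  ≤-trans (∑-≤-length-of-support (f ∘ suc) a (b ∸ 1) (f≤1 ∘ suc) outside′)
          (≤-reflexive (∸-+-assoc b 1 a))
  where
  outside′ : ∀ i → toℕ i < a ⊎ b ∸ 1 ≤ toℕ i → f (suc i) ≡ 0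
  outside′ i (inj₁ i<a) = outside (suc i) (inj₁ (s≤s i<a))
  outside′ i (inj₂ b∸1≤i) = outside (suc i) (inj₂ (≤-trans (m≤n+m∸n b 1) (s≤s b∸1≤i)))

∑-window-≤ : ∀ {n} s len (h : Fin len → ℕ) (f : Fin n → ℕ) → s + len ≤ n →
  (∀ i v → toℕ v ≡ s + toℕ i → h i ≤ f v) → sum h ≤ sum f
∑-window-≤ zero zero h f _ _ = z≤n
∑-window-≤ {zero} zero (suc len) h f () _
∑-window-≤ {suc n} zero (suc len) h f (s≤s fits) h≤f =
  +-mono-≤ (h≤f zero zero refl)
    (∑-window-≤ zero len (h ∘ suc) (f ∘ suc) fits λ i v v≡i → h≤f (suc i) (suc v) (cong suc v≡i))
∑-window-≤ {zero} (suc s) len h f () _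
∑-window-≤ {suc n} (suc s) len h f (s≤s fits) h≤f =
  ≤-trans (∑-window-≤ s len h (f ∘ suc) fits λ i v v≡s+i → h≤f i (suc v) (cong suc v≡s+i))
          (m≤n+m _ (f zero))

∑-arithmetic-progression : ∀ k s → 2 * ∑[ i < k ] suc (s + toℕ i) ≡ k * (2 * s + suc k)
∑-arithmetic-progression zero s = refl
∑-arithmetic-progression (suc k) s = begin
  2 * (suc (s + 0) + ∑[ i < k ] suc (s + suc (toℕ i)))
    ≡⟨ cong (λ t → 2 * (suc (s + 0) + t)) (sum-cong-≗ {k} λ i → cong suc (+-suc s (toℕ i))) ⟩
  2 * (suc (s + 0) + ∑[ i < k ] suc (suc s + toℕ i))
    ≡⟨ *-distribˡ-+ 2 (suc (s + 0)) _ ⟩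
  2 * suc (s + 0) + 2 * ∑[ i < k ] suc (suc s + toℕ i)
    ≡⟨ cong (2 * suc (s + 0) +_) (∑-arithmetic-progression k (suc s)) ⟩
  2 * suc (s + 0) + k * (2 * suc s + suc k)
    ≡⟨ rearrange k s ⟩
  suc k * (2 * s + suc (suc k)) ∎
  where
  open ≡-Reasoning
  rearrange : ∀ k s → 2 * suc (s + 0) + k * (2 * suc s + suc k) ≡ suc k * (2 * s + suc (suc k))
  rearrange = solve-∀

ι-split : ∀ b x → x ≡ ι b * x + ι (not b) * x
ι-split true x = sym (trans (+-identityʳ _) (+-identityʳ x))
ι-split false x = sym (+-identityʳ x)

∑-scaled-split : ∀ {n} (w f g h : Fin n → ℕ) → (∀ u → f u ≡ g u + h u) →
  ∑[ u < n ] (w u * f u) ≡ ∑[ u < n ] (w u * g u) + ∑[ u < n ] (w u * h u)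
∑-scaled-split {n} w f g h f≡g+h =
  trans (sum-cong-≗ {n} λ u → trans (cong (w u *_) (f≡g+h u)) (*-distribˡ-+ (w u) (g u) (h u)))
        (∑-distrib-+ (λ u → w u * g u) (λ u → w u * h u))

module _ {n} (D : Digraph n) where

  outdegInto : (Fin n → Bool) → Fin n → ℕ
  outdegInto Q u = ∑[ v < n ] (ι (Q v) * ι (D u v))

  indegFrom : (Fin n → Bool) → Fin n → ℕ
  indegFrom P v = ∑[ u < n ] (ι (P u) * ι (D u v))

  arcs : (Fin n → Bool) → (Fin n → Bool) → ℕ
  arcs P Q = ∑[ u < n ] (ι (P u) * outdegInto Q u)

  outdeg-split : ∀ P u → outdeg D u ≡ outdegInto P u + outdegInto (not ∘ P) u
  outdeg-split P u = begin
    outdeg D u                                                      ≡⟨ outdeg≡∑ D u ⟩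
    ∑[ v < n ] ι (D u v)                                            ≡⟨ sum-cong-≗ {n} (λ v → ι-split (P v) (ι (D u v))) ⟩
    ∑[ v < n ] (ι (P v) * ι (D u v) + ι (not (P v)) * ι (D u v))    ≡⟨ ∑-distrib-+ {n} _ _ ⟩
    outdegInto P u + outdegInto (not ∘ P) u                         ∎
    where open ≡-Reasoning

  indeg-split : ∀ P v → indeg D v ≡ indegFrom P v + indegFrom (not ∘ P) v
  indeg-split P v = begin
    indeg D v                                                       ≡⟨ indeg≡∑ D v ⟩
    ∑[ u < n ] ι (D u v)                                            ≡⟨ sum-cong-≗ {n} (λ u → ι-split (P u) (ι (D u v))) ⟩
    ∑[ u < n ] (ι (P u) * ι (D u v) + ι (not (P u)) * ι (D u v))    ≡⟨ ∑-distrib-+ {n} _ _ ⟩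
    indegFrom P v + indegFrom (not ∘ P) v                           ∎
    where open ≡-Reasoning

  arcs≡∑-indegFrom : ∀ P Q → arcs P Q ≡ ∑[ v < n ] (ι (Q v) * indegFrom P v)
  arcs≡∑-indegFrom P Q = begin
    ∑[ u < n ] (ι (P u) * ∑[ v < n ] (ι (Q v) * ι (D u v)))
      ≡⟨ sum-cong-≗ {n} (λ u → *-distribˡ-sum {n} (ι (P u)) _) ⟩
    ∑[ u < n ] ∑[ v < n ] (ι (P u) * (ι (Q v) * ι (D u v)))
      ≡⟨ ∑-comm (λ u v → ι (P u) * (ι (Q v) * ι (D u v))) ⟩
    ∑[ v < n ] ∑[ u < n ] (ι (P u) * (ι (Q v) * ι (D u v)))
      ≡⟨ sum-cong-≗ {n} (λ v → sum-cong-≗ {n} λ u → x*[y*z]≡y*[x*z] (ι (P u)) (ι (Q v)) _) ⟩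
    ∑[ v < n ] ∑[ u < n ] (ι (Q v) * (ι (P u) * ι (D u v)))
      ≡⟨ sum-cong-≗ {n} (λ v → *-distribˡ-sum {n} (ι (Q v)) _) ⟨
    ∑[ v < n ] (ι (Q v) * indegFrom P v) ∎
    where
    open ≡-Reasoning
    x*[y*z]≡y*[x*z] : ∀ x y z → x * (y * z) ≡ y * (x * z)
    x*[y*z]≡y*[x*z] = solve-∀

  balanced⇒arcs-out≡arcs-in : (∀ u → outdeg D u ≡ indeg D u) →
    ∀ P → arcs P (not ∘ P) ≡ arcs (not ∘ P) P
  balanced⇒arcs-out≡arcs-in balanced P = +-cancelˡ-≡ (arcs P P) _ _ (begin
    arcs P P + arcs P (not ∘ P)
      ≡⟨ ∑-scaled-split (ι ∘ P) (outdeg D) _ _ (outdeg-split P) ⟨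
    ∑[ u < n ] (ι (P u) * outdeg D u)
      ≡⟨ sum-cong-≗ {n} (λ u → cong (ι (P u) *_) (balanced u)) ⟩
    ∑[ v < n ] (ι (P v) * indeg D v)
      ≡⟨ ∑-scaled-split (ι ∘ P) (indeg D) _ _ (indeg-split P) ⟩
    ∑[ v < n ] (ι (P v) * indegFrom P v) + ∑[ v < n ] (ι (P v) * indegFrom (not ∘ P) v)
      ≡⟨ cong₂ _+_ (arcs≡∑-indegFrom P P) (arcs≡∑-indegFrom (not ∘ P) P) ⟨
    arcs P P + arcs (not ∘ P) P ∎)
    where open ≡-Reasoning

injection-into⇒≤∣S∣ : ∀ {m n} {S : Subset n} (f : Fin m → Fin n) → Injective _≡_ _≡_ f →
  (∀ i → f i ∈ S) → m ≤ ∣ S ∣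
injection-into⇒≤∣S∣ {zero} f inj f∈S = z≤n
injection-into⇒≤∣S∣ {suc m} f inj f∈S =
  ≤-<-trans (injection-into⇒≤∣S∣ (f ∘ suc) (Fin.suc-injective ∘ inj) f∘suc∈S-f₀) (x∈p⇒∣p-x∣<∣p∣ (f∈S zero))
  where
  f∘suc∈S-f₀ : ∀ i → f (suc i) ∈ _ - f zero
  f∘suc∈S-f₀ i = x∈p∧x≢y⇒x∈p-y (f∈S (suc i)) (λ e → case inj e of λ ())

survivor : ∀ {m n} (S : Subset n) → ∣ S ∣ < m → (f : Fin m → Fin n) → Injective _≡_ _≡_ f →
  ∃[ i ] f i ∉ S
survivor {m} S ∣S∣<m f inj with all? (λ i → f i ∈? S)
... | yes all∈S = contradiction (injection-into⇒≤∣S∣ f inj all∈S) (<⇒≱ ∣S∣<m)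
... | no ¬all∈S = ¬∀⟶∃¬ m _ (λ i → f i ∈? S) ¬all∈S

survivor₂ : ∀ {m n} (S : Subset n) → ∣ S ∣ < m → (f g : Fin m → Fin n) →
  Injective _≡_ _≡_ f → Injective _≡_ _≡_ g → (∀ i j → f i ≢ g j) →
  ∃[ i ] (f i ∉ S × g i ∉ S)
survivor₂ {m} {n} S ∣S∣<m f g f-inj g-inj f≢g with all? (λ i → f i ∈? S ⊎-dec g i ∈? S)
... | no ¬all-hit = let i , ¬hit = ¬∀⟶∃¬ m _ (λ i → f i ∈? S ⊎-dec g i ∈? S) ¬all-hit
                    in i , ¬hit ∘ inj₁ , ¬hit ∘ inj₂
... | yes all-hit = contradiction (injection-into⇒≤∣S∣ hit hit-injective hit∈S) (<⇒≱ ∣S∣<m)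
  where
  -- If every pair meets S, picking the member of each pair that lies in S is an injection into S.
  pick : ∀ i → Dec (f i ∈ S) → Fin n
  pick i (yes _) = f i
  pick i (no _)  = g i

  hit : Fin m → Fin n
  hit i = pick i (f i ∈? S)

  hit∈S : ∀ i → hit i ∈ S
  hit∈S i with f i ∈? S | all-hit i
  ... | yes fi∈S | _         = fi∈S
  ... | no fi∉S  | inj₁ fi∈S = contradiction fi∈S fi∉S
  ... | no _     | inj₂ gi∈S = gi∈S

  hit-injective : Injective _≡_ _≡_ hit
  hit-injective {i} {j} e with f i ∈? S | f j ∈? S
  ... | yes _ | yes _ = f-inj e
  ... | no _  | no _  = g-inj e
  ... | yes _ | no _  = contradiction e (f≢g i j)
  ... | no _  | yes _ = contradiction (sym e) (f≢g j i)

module _ {n} {D : Digraph n} {S : Subset n} where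

  infixr 5 _++ₚ_
  _++ₚ_ : ∀ {u w v} → PathAvoiding D S u w → PathAvoiding D S w v → PathAvoiding D S u v
  here _        ++ₚ q = q
  step u∉S e p ++ₚ q = step u∉S e (p ++ₚ q)

  arc⇒path : ∀ {u v} → u ∉ S → v ∉ S → D u v ≡ true → PathAvoiding D S u v
  arc⇒path u∉S v∉S e = step u∉S e (here v∉S)

module Reorientation {Reversed : ℕ → ℕ → Set} (reversed? : ∀ a b → Dec (Reversed a b)) where

  arc : ℕ → ℕ → Bool
  arc a b with <-cmp a b
  ... | tri< _ _ _ = not (does (reversed? a b))
  ... | tri≈ _ _ _ = false
  ... | tri> _ _ _ = does (reversed? b a)

  reorient : ∀ {n} → Digraph n
  reorient u v = arc (toℕ u) (toℕ v)

  forward-arc : ∀ {a b} → a < b → ¬ Reversed a b → arc a b ≡ true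
  forward-arc {a} {b} a<b ¬rev with <-cmp a b
  ... | tri< _ _ _    = cong not (dec-false (reversed? a b) ¬rev)
  ... | tri≈ a≮b _ _ = contradiction a<b a≮b
  ... | tri> a≮b _ _ = contradiction a<b a≮b

  backward-arc : ∀ {a b} → b < a → Reversed b a → arc a b ≡ true
  backward-arc {a} {b} b<a rev with <-cmp a b
  ... | tri< _ _ b≮a = contradiction b<a b≮a
  ... | tri≈ _ _ b≮a = contradiction b<a b≮a
  ... | tri> _ _ _    = dec-true (reversed? b a) rev

  arc-inversion : ∀ {a b} → arc a b ≡ true → (a < b × ¬ Reversed a b) ⊎ (b < a × Reversed b a)
  arc-inversion {a} {b} e with <-cmp a b
  ... | tri≈ _ _ _ = contradiction e λ ()
  ... | tri< a<b _ _ with reversed? a b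
  ...   | no ¬rev = inj₁ (a<b , ¬rev)
  ...   | yes _   = contradiction e λ ()
  arc-inversion {a} {b} e | tri> _ _ b<a with reversed? b a
  ...   | yes rev = inj₂ (b<a , rev)
  ...   | no _    = contradiction e λ ()

  one-way : ∀ {a b} → a < b → (arc a b ≡ true) ⊎ (arc b a ≡ true)
  one-way {a} {b} a<b with reversed? a b
  ... | yes rev = inj₂ (backward-arc a<b rev)
  ... | no ¬rev = inj₁ (forward-arc a<b ¬rev)

  reorient-isTournament : ∀ {n} → IsTournament (reorient {n})
  reorient-isTournament = loopless , total , antisymmetric
    where
    loopless : ∀ u → reorient u u ≡ false
    loopless u with arc (toℕ u) (toℕ u) in e
    ... | false = refl
    ... | true with arc-inversion {toℕ u} {toℕ u} e
    ...   | inj₁ (a<a , _) = contradiction a<a (<-irrefl refl)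
    ...   | inj₂ (a<a , _) = contradiction a<a (<-irrefl refl)

    total : ∀ u v → u ≢ v → (reorient u v ≡ true) ⊎ (reorient v u ≡ true)
    total u v u≢v = by-trichotomy (<-cmp (toℕ u) (toℕ v))
      where
      by-trichotomy : Tri (toℕ u < toℕ v) (toℕ u ≡ toℕ v) (toℕ v < toℕ u) →
                      (reorient u v ≡ true) ⊎ (reorient v u ≡ true)
      by-trichotomy (tri< u<v _ _) = one-way u<v
      by-trichotomy (tri≈ _ e _)   = contradiction (toℕ-injective e) u≢v
      by-trichotomy (tri> _ _ v<u) = swap (one-way v<u)

    antisymmetric : ∀ u v → reorient u v ≡ true → reorient v u ≡ false
    antisymmetric u v e with arc (toℕ v) (toℕ u) in e′
    ... | false = refl
    ... | true with arc-inversion {toℕ u} {toℕ v} e | arc-inversion {toℕ v} {toℕ u} e′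
    ...   | inj₁ (u<v , _)    | inj₁ (v<u , _)   = contradiction u<v (<-asym v<u)
    ...   | inj₁ (_ , ¬rev)     | inj₂ (_ , rev)     = contradiction rev ¬rev
    ...   | inj₂ (_ , rev)      | inj₁ (_ , ¬rev)    = contradiction rev ¬rev
    ...   | inj₂ (v<u , _)    | inj₂ (u<v , _)   = contradiction u<v (<-asym v<u)

module Rotation (N : ℕ) .{{_ : NonZero N}} where

  _⊕_ : ℕ → ℕ → ℕ
  i ⊕ e = (i + e) % N

  ⊕<N : ∀ i e → i ⊕ e < N
  ⊕<N i e = m%n<n (i + e) N

  ⊕-identityʳ : ∀ {i} → i < N → i ⊕ 0 ≡ i
  ⊕-identityʳ {i} i<N = trans (cong (_% N) (+-identityʳ i)) (m<n⇒m%n≡m i<N)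

  ⊕-comm : ∀ i e → i ⊕ e ≡ e ⊕ i
  ⊕-comm i e = cong (_% N) (+-comm i e)

  ⊕-⊕ : ∀ i e f → (i ⊕ e) ⊕ f ≡ i ⊕ (e + f)
  ⊕-⊕ i e f = begin
    ((i + e) % N + f) % N           ≡⟨ %-distribˡ-+ ((i + e) % N) f N ⟩
    ((i + e) % N % N + f % N) % N   ≡⟨ cong (λ a → (a + f % N) % N) (m%n%n≡m%n (i + e) N) ⟩
    ((i + e) % N + f % N) % N       ≡⟨ %-distribˡ-+ (i + e) f N ⟨
    (i + e + f) % N                 ≡⟨ cong (_% N) (+-assoc i e f) ⟩
    (i + (e + f)) % N               ∎
    where open ≡-Reasoning

  ⊕-N : ∀ {e} → e < N → e ⊕ N ≡ e
  ⊕-N {e} e<N = trans ([m+n]%n≡m%n e N) (m<n⇒m%n≡m e<N)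

  ⊕-injective : ∀ {i e e′} → i ≤ N → e < N → e′ < N → i ⊕ e ≡ i ⊕ e′ → e ≡ e′
  ⊕-injective {i} {e} {e′} i≤N e<N e′<N i⊕e≡i⊕e′ = begin
    e                      ≡⟨ ⊕-N e<N ⟨
    e ⊕ N                  ≡⟨ ⊕-complement e ⟨
    e ⊕ (i + (N ∸ i))      ≡⟨ ⊕-⊕ e i (N ∸ i) ⟨
    (e ⊕ i) ⊕ (N ∸ i)      ≡⟨ cong (_⊕ (N ∸ i)) (trans (⊕-comm e i) (trans i⊕e≡i⊕e′ (⊕-comm i e′))) ⟩
    (e′ ⊕ i) ⊕ (N ∸ i)     ≡⟨ ⊕-⊕ e′ i (N ∸ i) ⟩
    e′ ⊕ (i + (N ∸ i))     ≡⟨ ⊕-complement e′ ⟩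
    e′ ⊕ N                 ≡⟨ ⊕-N e′<N ⟩
    e′                     ∎
    where
    open ≡-Reasoning
    ⊕-complement : ∀ e → e ⊕ (i + (N ∸ i)) ≡ e ⊕ N
    ⊕-complement e = cong (e ⊕_) (m+[n∸m]≡n i≤N)

  ⊕-onto : ∀ {i j} → i ≤ N → j < N → ∃[ d ] (d < N × i ⊕ d ≡ j)
  ⊕-onto {i} {j} i≤N j<N = j ⊕ (N ∸ i) , ⊕<N j (N ∸ i) , (begin
    i ⊕ (j ⊕ (N ∸ i))      ≡⟨ ⊕-comm i _ ⟩
    (j ⊕ (N ∸ i)) ⊕ i      ≡⟨ ⊕-⊕ j (N ∸ i) i ⟩
    j ⊕ ((N ∸ i) + i)      ≡⟨ cong (j ⊕_) (m∸n+n≡m i≤N) ⟩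
    j ⊕ N                  ≡⟨ ⊕-N j<N ⟩
    j                      ∎)
    where open ≡-Reasoning

  ⊕-wrap : ∀ {i e} → i < N → e < N → N ≤ i + e → i ⊕ e + N ≡ i + e
  ⊕-wrap {i} {e} i<N e<N N≤i+e = trans (cong (_+ N) i⊕e≡i+e∸N) (m∸n+n≡m N≤i+e)
    where
    i+e∸N<N : i + e ∸ N < N
    i+e∸N<N = +-cancelʳ-< N _ N (subst (_< N + N) (sym (m∸n+n≡m N≤i+e)) (+-mono-< i<N e<N))
    i⊕e≡i+e∸N : i ⊕ e ≡ i + e ∸ N
    i⊕e≡i+e∸N = trans (sym (m≤n⇒[n∸m]%m≡n%m N≤i+e)) (m<n⇒m%n≡m i+e∸N<N)

width : ℕ → ℕ
width m = suc (m + m)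

module RotationalBlock {n} (D : Digraph n) (S : Subset n) {m} (∣S∣<m : ∣ S ∣ < m)
  (s : ℕ) (fits : s + width m ≤ n)
  (short-forward : ∀ {x y i j} → toℕ x ≡ s + i → toℕ y ≡ s + j → i < j → j < width m → j ∸ i ≤ m → D x y ≡ true)
  (long-backward : ∀ {x y i j} → toℕ x ≡ s + i → toℕ y ≡ s + j → j < i → i < width m → m < i ∸ j → D x y ≡ true)
  where

  N : ℕ
  N = width m

  open Rotation N

  _at_ : Fin n → ℕ → Set
  x at i = toℕ x ≡ s + i

  rotation-arc : ∀ {x y i e} → i < N → 0 < e → e ≤ m → x at i → y at (i ⊕ e) → D x y ≡ true
  rotation-arc {x} {y} {i} {e} i<N 0<e e≤m x-at-i y-at with i + e <? N
  ... | yes i+e<N = short-forward x-at-i y-at′ (m<m+n i 0<e) i+e<N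
                      (≤-trans (≤-reflexive (m+n∸m≡n i e)) e≤m)
    where y-at′ : y at (i + e)
          y-at′ = trans y-at (cong (s +_) (m<n⇒m%n≡m i+e<N))
  ... | no i+e≮N = long-backward x-at-i y-at j<i i<N (m+n≤o⇒m≤o∸n (suc m) (+-cancelʳ-≤ m _ i j+N≤i+m))
    where
    j = i ⊕ e
    e<N : e < N
    e<N = s≤s (≤-trans e≤m (m≤m+n m m))
    j+N≡i+e : j + N ≡ i + e
    j+N≡i+e = ⊕-wrap i<N e<N (≮⇒≥ i+e≮N)
    j<i : j < i
    j<i = +-cancelʳ-< N j i (subst (_< i + N) (sym j+N≡i+e) (+-monoʳ-< i e<N))
    j+N≤i+m : suc m + j + m ≤ i + m
    j+N≤i+m = subst (_≤ i + m) (sym (trans (rearrange m j) j+N≡i+e)) (+-monoʳ-≤ i e≤m)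
      where rearrange : ∀ m j → suc m + j + m ≡ j + suc (m + m)
            rearrange = solve-∀

  survivor-at : (g : ℕ → ℕ) → (∀ {t} → t < m → g t < N) →
    (∀ {t t′} → t < m → t′ < m → g t ≡ g t′ → t ≡ t′) →
    ∃[ w ] (w ∉ S × ∃[ t ] (t < m × w at g t))
  survivor-at g g<N g-inj =
    let t , ft∉S = survivor S ∣S∣<m f f-injective
    in f t , ft∉S , toℕ t , toℕ<n t , toℕ-fromℕ< (bound t)
    where
    bound : (t : Fin m) → s + g (toℕ t) < n
    bound t = <-≤-trans (+-monoʳ-< s (g<N (toℕ<n t))) fits
    f : Fin m → Fin n
    f t = fromℕ< (bound t)
    f-injective : Injective _≡_ _≡_ f
    f-injective {t} {t′} ft≡ft′ = toℕ-injective (g-inj (toℕ<n t) (toℕ<n t′) (+-cancelˡ-≡ s _ _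
      (trans (sym (toℕ-fromℕ< (bound t))) (trans (cong toℕ ft≡ft′) (toℕ-fromℕ< (bound t′))))))

  reach-by-rotation : ∀ d → d < N → ∀ {x y i} → x ∉ S → y ∉ S → i < N →
    x at i → y at (i ⊕ d) → PathAvoiding D S x y
  -- Strong induction on the rotation distance d from x to y: some out-neighbour i ⊕ (t+1), t < m,
  -- of x survives the deletion of S, and it is strictly closer to y.
  reach-by-rotation = <-rec Reachable reachable
    where
    Reachable : ℕ → Set
    Reachable d = d < N → ∀ {x y i} → x ∉ S → y ∉ S → i < N →
      x at i → y at (i ⊕ d) → PathAvoiding D S x y

    reachable : ∀ d → (∀ {d′} → d′ < d → Reachable d′) → Reachable d
    reachable zero _ _ {x} x∉S y∉S i<N x-at y-at =
      subst (PathAvoiding D S x)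
            (toℕ-injective (trans x-at (sym (trans y-at (cong (s +_) (⊕-identityʳ i<N))))))
            (here x∉S)
    reachable (suc d) reach d<N {x} {y} {i} x∉S y∉S i<N x-at y-at with suc d ≤? m
    ... | yes d<m = arc⇒path x∉S y∉S (rotation-arc i<N (s≤s z≤n) d<m x-at y-at)
    ... | no d≮m =
      let w , w∉S , t , t<m , w-at = survivor-at (λ t → i ⊕ suc t) (λ {t} _ → ⊕<N i (suc t))
                                       (λ t<m t′<m e → suc-injective (⊕-injective (<⇒≤ i<N) (hop<N t<m) (hop<N t′<m) e))
      in arc⇒path x∉S w∉S (rotation-arc i<N (s≤s z≤n) t<m x-at w-at)
         ++ₚ reach (remaining<d t) (<-trans (remaining<d t) d<N) w∉S y∉S (⊕<N i _) w-at
                   (trans y-at (cong (s +_) (remaining-rotation t<m)))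
      where
      remaining<d : ∀ t → suc d ∸ suc t < suc d
      remaining<d t = s≤s (m∸n≤m d t)
      remaining-rotation : ∀ {t} → t < m → i ⊕ suc d ≡ (i ⊕ suc t) ⊕ (suc d ∸ suc t)
      remaining-rotation {t} t<m = trans (cong (i ⊕_) (sym (m+[n∸m]≡n t<d))) (sym (⊕-⊕ i (suc t) _))
        where t<d : suc t ≤ suc d
              t<d = ≤-trans t<m (<⇒≤ (≰⇒> d≮m))
      hop<N : ∀ {t} → t < m → suc t < N
      hop<N t<m = s≤s (≤-trans t<m (m≤m+n _ _))

  reach-within : ∀ {x y i j} → x ∉ S → y ∉ S → i < N → j < N → x at i → y at j →
    PathAvoiding D S x y
  reach-within {i = i} x∉S y∉S i<N j<N x-at y-at =
    let d , d<N , i⊕d≡j = ⊕-onto (<⇒≤ i<N) j<N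
    in reach-by-rotation d d<N x∉S y∉S i<N x-at (trans y-at (cong (s +_) (sym i⊕d≡j)))

  upper<N : ∀ {t} → t < m → m + suc t < N
  upper<N t<m = s≤s (+-monoʳ-≤ m t<m)

  live-upper-vertex : ∃[ w ] (w ∉ S × ∃[ t ] (t < m × w at (m + suc t)))
  live-upper-vertex = survivor-at (λ t → m + suc t) upper<N
    (λ _ _ e → suc-injective (+-cancelˡ-≡ m _ _ e))

  enter : ∀ {x y j} → x ∉ S → y ∉ S → j < N → y at j →
    (∀ {w k} → m < k → k < N → w at k → D x w ≡ true) → PathAvoiding D S x y
  enter x∉S y∉S j<N y-at x→upper =
    let w , w∉S , t , t<m , w-at = live-upper-vertex
    in arc⇒path x∉S w∉S (x→upper (m<m+n m (s≤s z≤n)) (upper<N t<m) w-at)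
       ++ₚ reach-within w∉S y∉S (upper<N t<m) j<N w-at y-at

  exit : ∀ {x y i} → x ∉ S → y ∉ S → i < N → x at i →
    (∀ {w k} → m < k → k < N → w at k → D w y ≡ true) → PathAvoiding D S x y
  exit x∉S y∉S i<N x-at upper→y =
    let w , w∉S , t , t<m , w-at = live-upper-vertex
    in reach-within x∉S w∉S i<N (upper<N t<m) x-at w-at
       ++ₚ arc⇒path w∉S y∉S (upper→y (m<m+n m (s≤s z≤n)) (upper<N t<m) w-at)

module Construction (n m : ℕ) where

  N : ℕ
  N = width m

  z : ℕ
  z = n ∸ N

  data Reversed (a b : ℕ) : Set where
    bottom-long : b < N → m < b ∸ a → Reversed a b
    top-long    : z ≤ a → m < b ∸ a → Reversed a b
    matching    : a < m → b ≡ a + z → Reversed a b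

  reversed? : ∀ a b → Dec (Reversed a b)
  reversed? a b with b <? N ×-dec m <? b ∸ a | z ≤? a ×-dec m <? b ∸ a | a <? m ×-dec b ≟ a + z
  ... | yes (p , q) | _           | _           = yes (bottom-long p q)
  ... | no _        | yes (p , q) | _           = yes (top-long p q)
  ... | no _        | no _        | yes (p , q) = yes (matching p q)
  ... | no ¬b       | no ¬t       | no ¬m       = no λ
    { (bottom-long p q) → ¬b (p , q)
    ; (top-long p q)    → ¬t (p , q)
    ; (matching p q)    → ¬m (p , q) }

  open Reorientation reversed? public

  T : Digraph n
  T = reorient

  arc-at : ∀ {x y : Fin n} {a b} → toℕ x ≡ a → toℕ y ≡ b → arc a b ≡ true → T x y ≡ true
  arc-at refl refl e = e

  module Connectivity (two-blocks : N + N ≤ n) where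

    N≤z : N ≤ z
    N≤z = m+n≤o⇒m≤o∸n N two-blocks

    N≤n : N ≤ n
    N≤n = m+n≤o⇒m≤o N two-blocks

    z+N≡n : z + N ≡ n
    z+N≡n = m∸n+n≡m N≤n

    m<N : m < N
    m<N = s≤s (m≤m+n m m)

    m<z : m < z
    m<z = <-≤-trans m<N N≤z

    bottom-short-forward : ∀ {x y i j} → toℕ x ≡ i → toℕ y ≡ j → i < j → j < N → j ∸ i ≤ m → T x y ≡ true
    bottom-short-forward x-at y-at i<j j<N j∸i≤m = arc-at x-at y-at (forward-arc i<j λ
      { (bottom-long _ long) → <⇒≱ long j∸i≤m
      ; (top-long z≤i _)     → <⇒≱ (<-trans i<j j<N) (≤-trans N≤z z≤i)
      ; (matching _ j≡i+z)   → <⇒≱ j<N (≤-trans N≤z (≤-trans (m≤n+m z _) (≤-reflexive (sym j≡i+z)))) })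

    bottom-long-backward : ∀ {x y i j} → toℕ x ≡ i → toℕ y ≡ j → j < i → i < N → m < i ∸ j → T x y ≡ true
    bottom-long-backward x-at y-at j<i i<N long = arc-at x-at y-at (backward-arc j<i (bottom-long i<N long))

    top-short-forward : ∀ {x y i j} → toℕ x ≡ z + i → toℕ y ≡ z + j → i < j → j < N → j ∸ i ≤ m → T x y ≡ true
    top-short-forward {i = i} {j} x-at y-at i<j j<N j∸i≤m = arc-at x-at y-at (forward-arc (+-monoʳ-< z i<j) λ
      { (bottom-long z+j<N _) → <⇒≱ z+j<N (≤-trans N≤z (m≤m+n z j))
      ; (top-long _ long)      → <⇒≱ long (subst (_≤ m) (sym ([m+n]∸[m+o]≡n∸o z j i)) j∸i≤m)
      ; (matching z+i<m _)     → <⇒≱ z+i<m (≤-trans (<⇒≤ m<z) (m≤m+n z i)) })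

    top-long-backward : ∀ {x y i j} → toℕ x ≡ z + i → toℕ y ≡ z + j → j < i → i < N → m < i ∸ j → T x y ≡ true
    top-long-backward {i = i} {j} x-at y-at j<i i<N long = arc-at x-at y-at (backward-arc (+-monoʳ-< z j<i)
      (top-long (m≤m+n z j) (subst (m <_) (sym ([m+n]∸[m+o]≡n∸o z i j)) long)))

    bottom-vertex top-vertex : Fin m → Fin n
    bottom-vertex i = fromℕ< (<-trans (toℕ<n i) (<-≤-trans m<N N≤n))
    top-vertex i = fromℕ< (subst (z + toℕ i <_) z+N≡n (+-monoʳ-< z (<-trans (toℕ<n i) m<N)))

    matching-arc : ∀ i → T (top-vertex i) (bottom-vertex i) ≡ true
    matching-arc i = arc-at {top-vertex i} {bottom-vertex i} (toℕ-fromℕ< _) (toℕ-fromℕ< _)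
      (backward-arc (<-≤-trans (<-trans (toℕ<n i) m<z) (m≤m+n z _)) (matching (toℕ<n i) (+-comm z _)))

    module _ {S : Subset n} (∣S∣<m : ∣ S ∣ < m) where

      module Bottom = RotationalBlock T S ∣S∣<m 0 N≤n bottom-short-forward bottom-long-backward
      module Top    = RotationalBlock T S ∣S∣<m z (≤-reflexive z+N≡n) top-short-forward top-long-backward

      to-top : ∀ {x v j} → x ∉ S → v ∉ S → j < N → toℕ v ≡ z + j → PathAvoiding T S x v
      to-top {x} x∉S v∉S j<N v-at with z ≤? toℕ x
      ... | yes z≤x = Top.reach-within x∉S v∉S x-index<N j<N (sym (m+[n∸m]≡n z≤x)) v-at
        where
        x-index<N : toℕ x ∸ z < N
        x-index<N = +-cancelˡ-< z _ _ (subst₂ _<_ (sym (m+[n∸m]≡n z≤x)) (sym z+N≡n) (toℕ<n x))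
      ... | no z≰x = Top.enter x∉S v∉S j<N v-at x→upper
        where
        x→upper : ∀ {w k} → m < k → k < N → toℕ w ≡ z + k → T x w ≡ true
        x→upper {k = k} m<k k<N w-at = arc-at {x} refl w-at (forward-arc (<-≤-trans (≰⇒> z≰x) (m≤m+n z k)) λ
          { (bottom-long z+k<N _) → <⇒≱ z+k<N (≤-trans N≤z (m≤m+n z k))
          ; (top-long z≤x _)       → z≰x z≤x
          ; (matching x<m z+k≡x+z) →
              <-irrefl (sym (+-cancelˡ-≡ z k _ (trans z+k≡x+z (+-comm _ z)))) (<-trans x<m m<k) })

      from-bottom : ∀ {v y i} → v ∉ S → y ∉ S → i < N → toℕ v ≡ i → PathAvoiding T S v y
      from-bottom {y = y} v∉S y∉S i<N v-at with toℕ y <? N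
      ... | yes y<N = Bottom.reach-within v∉S y∉S i<N y<N v-at refl
      ... | no y≮N = Bottom.exit v∉S y∉S i<N v-at upper→y
        where
        upper→y : ∀ {w k} → m < k → k < N → toℕ w ≡ k → T w y ≡ true
        upper→y {w} m<k k<N w-at = arc-at {w} {y} w-at refl (forward-arc (<-≤-trans k<N (≮⇒≥ y≮N)) λ
          { (bottom-long y<N _) → y≮N y<N
          ; (top-long z≤k _)    → <⇒≱ k<N (≤-trans N≤z z≤k)
          ; (matching k<m _)    → <-asym k<m m<k })

      live-matching-pair : ∃[ i ] (bottom-vertex i ∉ S × top-vertex i ∉ S)
      live-matching-pair = survivor₂ S ∣S∣<m bottom-vertex top-vertex
        (λ e → toℕ-injective (fromℕ<-injective _ _ _ _ e))
        (λ e → toℕ-injective (+-cancelˡ-≡ z _ _ (fromℕ<-injective _ _ _ _ e)))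
        λ i j e → <⇒≱ (<-trans (toℕ<n i) m<z)
                      (≤-trans (m≤m+n z (toℕ j)) (≤-reflexive (sym (fromℕ<-injective _ _ _ _ e))))

      strongly-connected-minus : StronglyConnectedMinus T S
      strongly-connected-minus x y x∉S y∉S =
        let i , bottom∉S , top∉S = live-matching-pair
            i<N = <-trans (toℕ<n i) m<N
        in to-top x∉S top∉S i<N (toℕ-fromℕ< _)
           ++ₚ arc⇒path top∉S bottom∉S (matching-arc i)
           ++ₚ from-bottom bottom∉S y∉S i<N (toℕ-fromℕ< _)

    T-strongly-connected : StronglyConnected m T
    T-strongly-connected = <-≤-trans m<N N≤n , λ _ → strongly-connected-minus

  middle-arc-forward : ∀ {u v} → N ≤ toℕ u → toℕ u < z → toℕ v < z → T u v ≡ true → toℕ u < toℕ v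
  middle-arc-forward {u} {v} N≤u u<z v<z e with arc-inversion {toℕ u} {toℕ v} e
  ... | inj₁ (u<v , _)                 = u<v
  ... | inj₂ (_ , bottom-long u<N _)   = contradiction N≤u (<⇒≱ u<N)
  ... | inj₂ (_ , top-long z≤v _)      = contradiction z≤v (<⇒≱ v<z)
  ... | inj₂ (_ , matching _ u≡v+z)    =
    contradiction (≤-trans (m≤n+m z _) (≤-reflexive (sym u≡v+z))) (<⇒≱ u<z)

  module Degree (ℓ : ℕ) (fits : N + ℓ + N ≤ n) where

    p : ℕ
    p = N + ℓ

    p≤z : p ≤ z
    p≤z = m+n≤o⇒m≤o∸n p fits

    inPrefix : Fin n → Bool
    inPrefix v = toℕ v <ᵇ p

    inPrefix-true : ∀ {v} → inPrefix v ≡ true → toℕ v < p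
    inPrefix-true {v} e = <ᵇ⇒< (toℕ v) p (Equivalence.from T-≡ e)

    inPrefix-false : ∀ {v} → inPrefix v ≡ false → p ≤ toℕ v
    inPrefix-false {v} e = ≮⇒≥ λ v<p → case trans (sym e) (Equivalence.to T-≡ (<⇒<ᵇ v<p)) of λ ()

    arc-into-prefix : ∀ {u v} → toℕ v < p → p ≤ toℕ u → T u v ≡ true → toℕ v < m × toℕ u ≡ toℕ v + z
    arc-into-prefix {u} {v} v<p p≤u e with arc-inversion {toℕ u} {toℕ v} e
    ... | inj₁ (u<v , _)                 = contradiction (<-trans u<v v<p) (≤⇒≯ p≤u)
    ... | inj₂ (_ , bottom-long u<N _)   = contradiction (<-≤-trans u<N (m≤m+n N ℓ)) (≤⇒≯ p≤u)
    ... | inj₂ (_ , top-long z≤v _)      = contradiction (<-≤-trans v<p p≤z) (≤⇒≯ z≤v)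
    ... | inj₂ (_ , matching v<m u≡v+z)  = v<m , u≡v+z

    module _ {D : Digraph n} {r : ℕ} (D⊆T : D ⊆D T) (regular : Regular D r) where

      incoming-term≡0 : ∀ {u v} → toℕ v < p → ¬ (toℕ v < m × toℕ u ≡ toℕ v + z) →
        ι (not (inPrefix u)) * ι (D u v) ≡ 0
      incoming-term≡0 {u} {v} v<p not-matching with inPrefix u in u∈P | D u v in e
      ... | true  | _     = refl
      ... | false | false = refl
      ... | false | true  = contradiction (arc-into-prefix v<p (inPrefix-false u∈P) (D⊆T u v e)) not-matching

      incoming≤1 : ∀ v → ι (inPrefix v) * indegFrom D (not ∘ inPrefix) v ≤ 1
      incoming≤1 v with inPrefix v in v∈P
      ... | false = z≤n
      ... | true  = begin
        1 * indegFrom D (not ∘ inPrefix) v      ≡⟨ *-identityˡ _ ⟩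
        indegFrom D (not ∘ inPrefix) v          ≤⟨ ∑-≤-length-of-support _ c (suc c) (λ u → ι*ι≤1 (not (inPrefix u)) (D u v))
                                              (λ u outside → incoming-term≡0 (inPrefix-true v∈P) λ (_ , u≡c) → off-c u outside u≡c) ⟩
        suc c ∸ c                        ≡⟨ m+n∸n≡m 1 c ⟩
        1                                ∎
        where
        open ≤-Reasoning
        c = toℕ v + z
        off-c : ∀ u → toℕ u < c ⊎ suc c ≤ toℕ u → toℕ u ≢ c
        off-c u (inj₁ u<c) u≡c = <-irrefl u≡c u<c
        off-c u (inj₂ c<u) u≡c = <-irrefl (sym u≡c) c<u

      incoming≡0 : ∀ v → m ≤ toℕ v → ι (inPrefix v) * indegFrom D (not ∘ inPrefix) v ≡ 0
      incoming≡0 v m≤v with inPrefix v in v∈P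
      ... | false = refl
      ... | true  = trans (*-identityˡ _) (∑-zero {n} λ u → incoming-term≡0 {u} (inPrefix-true v∈P) λ (v<m , _) → <⇒≱ v<m m≤v)

      arcs-into-prefix≤m : arcs D (not ∘ inPrefix) inPrefix ≤ m
      arcs-into-prefix≤m = begin
        arcs D (not ∘ inPrefix) inPrefix                               ≡⟨ arcs≡∑-indegFrom D (not ∘ inPrefix) inPrefix ⟩
        ∑[ v < n ] (ι (inPrefix v) * indegFrom D (not ∘ inPrefix) v)   ≤⟨ ∑-≤-length-of-support _ 0 m incoming≤1 outside ⟩
        m                                                ∎
        where
        open ≤-Reasoning
        outside : ∀ v → toℕ v < 0 ⊎ m ≤ toℕ v → ι (inPrefix v) * indegFrom D (not ∘ inPrefix) v ≡ 0
        outside v (inj₂ m≤v) = incoming≡0 v m≤v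

      outgoing-term≡0 : ∀ {u} → N ≤ toℕ u → toℕ u < p →
        ∀ v → toℕ v < suc (toℕ u) ⊎ p ≤ toℕ v → ι (inPrefix v) * ι (D u v) ≡ 0
      outgoing-term≡0 {u} N≤u u<p v outside with inPrefix v in v∈P | D u v in e | outside
      ... | false | _     | _          = refl
      ... | true  | false | _          = *-zeroʳ 1
      ... | true  | true  | inj₂ p≤v   = contradiction (inPrefix-true v∈P) (≤⇒≯ p≤v)
      ... | true  | true  | inj₁ v≤u   =
        contradiction (middle-arc-forward N≤u (<-≤-trans u<p p≤z) (<-≤-trans (inPrefix-true v∈P) p≤z) (D⊆T u v e))
                      (≤⇒≯ (≤-pred v≤u))

      window<p : ∀ (i : Fin ℓ) {u : Fin n} → toℕ u ≡ N + toℕ i → toℕ u < p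
      window<p i u-at = subst (_< p) (sym u-at) (+-monoʳ-< N (toℕ<n i))

      outgoing≥ : ℓ ≤ r → ∀ (i : Fin ℓ) u → toℕ u ≡ N + toℕ i →
        suc (toℕ i) ≤ ι (inPrefix u) * outdegInto D (not ∘ inPrefix) u
      outgoing≥ ℓ≤r i u u-at with inPrefix u in u∈P
      ... | false = contradiction (window<p i u-at) (≤⇒≯ (inPrefix-false u∈P))
      ... | true  = subst (suc (toℕ i) ≤_) (sym (*-identityˡ _)) (+-cancelʳ-≤ a _ _ (begin
        suc (toℕ i) + a                  ≤⟨ +-monoʳ-≤ (suc (toℕ i)) a≤ℓ∸[1+i] ⟩
        suc (toℕ i) + (ℓ ∸ suc (toℕ i))  ≡⟨ m+[n∸m]≡n (toℕ<n i) ⟩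
        ℓ                                ≤⟨ ℓ≤r ⟩
        r                                ≡⟨ trans (sym (proj₁ (regular u))) (outdeg-split D inPrefix u) ⟩
        a + outdegInto D (not ∘ inPrefix) u     ≡⟨ +-comm a _ ⟩
        outdegInto D (not ∘ inPrefix) u + a     ∎))
        where
        open ≤-Reasoning
        a = outdegInto D inPrefix u
        a≤ℓ∸[1+i] : a ≤ ℓ ∸ suc (toℕ i)
        a≤ℓ∸[1+i] = begin
          a                       ≤⟨ ∑-≤-length-of-support _ (suc (toℕ u)) p (λ v → ι*ι≤1 (inPrefix v) (D u v))
                                       (outgoing-term≡0 (subst (N ≤_) (sym u-at) (m≤m+n N (toℕ i))) (window<p i u-at)) ⟩
          p ∸ suc (toℕ u)         ≡⟨ cong (λ t → p ∸ suc t) u-at ⟩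
          N + ℓ ∸ suc (N + toℕ i) ≡⟨ cong (N + ℓ ∸_) (sym (+-suc N (toℕ i))) ⟩
          N + ℓ ∸ (N + suc (toℕ i)) ≡⟨ [m+n]∸[m+o]≡n∸o N ℓ (suc (toℕ i)) ⟩
          ℓ ∸ suc (toℕ i)         ∎

      arcs-out-of-prefix≥ : ℓ ≤ r → ∑[ i < ℓ ] suc (toℕ i) ≤ arcs D inPrefix (not ∘ inPrefix)
      arcs-out-of-prefix≥ ℓ≤r = ∑-window-≤ N ℓ _ _ (m+n≤o⇒m≤o p fits) (outgoing≥ ℓ≤r)

      triangle≤m : ℓ ≤ r → ∑[ i < ℓ ] suc (toℕ i) ≤ m
      triangle≤m ℓ≤r = begin
        ∑[ i < ℓ ] suc (toℕ i)  ≤⟨ arcs-out-of-prefix≥ ℓ≤r ⟩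
        arcs D inPrefix (not ∘ inPrefix)      ≡⟨ balanced⇒arcs-out≡arcs-in D (λ u → trans (proj₁ (regular u)) (sym (proj₂ (regular u)))) inPrefix ⟩
        arcs D (not ∘ inPrefix) inPrefix      ≤⟨ arcs-into-prefix≤m ⟩
        m                       ∎
        where open ≤-Reasoning

quarter-square<triangle : ∀ k → (k * k) / 4 < ∑[ i < suc k ] suc (toℕ i)
quarter-square<triangle k = *-cancelʳ-< 4 _ _ (begin-strict
  (k * k) / 4 * 4                            ≤⟨ m/n*n≤m (k * k) 4 ⟩
  k * k                                      <⟨ *-mono-< (n<1+n k) (≤-trans (n<1+n k) (n≤1+n _)) ⟩
  suc k * suc (suc k)                        ≤⟨ m≤m*n _ 2 ⟩
  suc k * suc (suc k) * 2                    ≡⟨ cong (_* 2) (∑-arithmetic-progression (suc k) 0) ⟨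
  2 * ∑[ i < suc k ] suc (toℕ i) * 2         ≡⟨ 2*t*2≡t*4 (∑[ i < suc k ] suc (toℕ i)) ⟩
  ∑[ i < suc k ] suc (toℕ i) * 4             ∎)
  where
  open ≤-Reasoning
  2*t*2≡t*4 : ∀ t → 2 * t * 2 ≡ t * 4
  2*t*2≡t*4 = solve-∀

blocks-fit : ∀ {m k n} → m * 4 ≤ k * k → k * k + k + 2 < n → width m + suc k + width m ≤ n
blocks-fit {m} {k} {n} 4m≤k² k²+k+2<n = begin
  width m + suc k + width m   ≡⟨ rearrange m k ⟩
  suc (m * 4 + k + 2)         ≤⟨ s≤s (+-monoˡ-≤ 2 (+-monoˡ-≤ k 4m≤k²)) ⟩
  suc (k * k + k + 2)         ≤⟨ k²+k+2<n ⟩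
  n                           ∎
  where
  open ≤-Reasoning
  rearrange : ∀ m k → suc (m + m) + suc k + suc (m + m) ≡ suc (m * 4 + k + 2)
  rearrange = solve-∀

proposition5p1 : ∀ (n k : ℕ) → 2 ≤ k → k * k + k + 2 < n →
    Σ (Digraph n) (λ T →
      IsTournament T
      × StronglyConnected ((k * k) / 4) T
      × (∀ (D : Digraph n) (r : ℕ) → D ⊆D T → Regular D r → r ≤ k))
proposition5p1 n k _ k²+k+2<n =
  T , reorient-isTournament , Connectivity.T-strongly-connected two-blocks , degree≤k
  where
  open Construction n ((k * k) / 4)

  fits : N + suc k + N ≤ n
  fits = blocks-fit {(k * k) / 4} (m/n*n≤m (k * k) 4) k²+k+2<n

  two-blocks : N + N ≤ n
  two-blocks = ≤-trans (+-monoˡ-≤ N (m≤m+n N (suc k))) fits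

  degree≤k : ∀ D r → D ⊆D T → Regular D r → r ≤ k
  degree≤k D r D⊆T regular = ≮⇒≥ λ k<r →
    <⇒≱ (quarter-square<triangle k) (Degree.triangle≤m (suc k) fits D⊆T regular k<r)
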